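{- For every graph $G$, $\dim_{\mathrm{TH}}(G)\ge\min\{\chi(G-C): C \text{ is a clique of } G\}$, where $C$ ranges over all cliques of $G$ (including the empty set) and $G-C$ is the subgraph of $G$ induced by $V(G)\setminus C$.
   Context: $\chi$ denotes the chromatic number (with $\chi$ of the graph on no vertices equal to $0$). A graph $H$ on $N$ vertices is a threshold graph if there exist real numbers $a_1,\dots,a_N,b$ such that the $0$-$1$ solutions of $\sum a_ix_i\le b$ are exactly the characteristic vectors of the cliques of $H$ (equivalently, $H$ has no induced $2K_2$, $P_4$ or $C_4$). The threshold dimension $\dim_{\mathrm{TH}}(G)$ is the smallest $k$ such that there are threshold graphs $G_1,\dots,G_k$ on $V(G)$ with $E(G)=\bigcap_i E(G_i)$.
   Formalization: The weights $a_1,\dots,a_N,b$ defining a threshold graph are rational instead of real. -}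

module Defs where

open import Data.Nat using (ℕ; zero; suc) renaming (_≤_ to _≤ℕ_)
open import Data.Fin using (Fin)
import Data.Fin as F
open import Data.Bool using (Bool; true; false; if_then_else_)
open import Data.Rational using (ℚ; 0ℚ; _+_; _≤_)
open import Data.Product using (Σ; ∃; ∃-syntax; _×_; _,_; proj₁)
open import Relation.Binary.PropositionalEquality using (_≡_; _≢_)
open import Relation.Nullary using (¬_)
open import Function.Bundles using (_⇔_)

record Graph (V : Set) : Set₁ where
  field
    Adj    : V → V → Set
    sym    : ∀ {u v} → Adj u v → Adj v u
    irrefl : ∀ {v} → ¬ Adj v v
open Graph public

FinGraph : ℕ → Set₁
FinGraph n = Graph (Fin n)

IsClique : ∀ {V : Set} → Graph V → (V → Bool) → Set
IsClique G C = ∀ u v → C u ≡ true → C v ≡ true → u ≢ v → Adj G u v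

_－_ : ∀ {V : Set} → Graph V → (C : V → Bool) → Graph (Σ V (λ v → C v ≡ false))
G － C = record
  { Adj    = λ u v → Adj G (proj₁ u) (proj₁ v)
  ; sym    = sym G
  ; irrefl = irrefl G
  }


Colorable : ∀ {V : Set} → Graph V → ℕ → Set
Colorable {V} G k = Σ (V → Fin k) (λ f → ∀ u v → Adj G u v → f u ≢ f v)

IsChromaticNumber : ∀ {V : Set} → Graph V → ℕ → Set
IsChromaticNumber G c = Colorable G c × (∀ k → Colorable G k → c ≤ℕ k)

wsum : ∀ {n} → (Fin n → ℚ) → (Fin n → Bool) → ℚ
wsum {zero}  a x = 0ℚ
wsum {suc n} a x = (if x F.zero then a F.zero else 0ℚ) + wsum (λ i → a (F.suc i)) (λ i → x (F.suc i))

IsThreshold : ∀ {n} → FinGraph n → Set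
IsThreshold {n} H =
  ∃[ a ] ∃[ b ] (∀ (x : Fin n → Bool) → (wsum {n} a x ≤ b) ⇔ IsClique H x)

ThresholdRep : ∀ {n} → FinGraph n → ℕ → Set₁
ThresholdRep {n} G k =
  Σ (Fin k → FinGraph n) λ Gs →
    (∀ i → IsThreshold (Gs i)) ×
    (∀ u v → Adj G u v ⇔ (∀ i → Adj (Gs i) u v))

IsThresholdDim : ∀ {n} → FinGraph n → ℕ → Set₁
IsThresholdDim G d = ThresholdRep G d × (∀ k → ThresholdRep G k → d ≤ℕ k)

IsMinChiOverCliques : ∀ {n} → FinGraph n → ℕ → Set
IsMinChiOverCliques G m =
  (∃[ C ] (IsClique G C × IsChromaticNumber (G － C) m)) ×
  (∀ C c → IsClique G C → IsChromaticNumber (G － C) c → m ≤ℕ c)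

{-# OPTIONS --safe #-}
-- Suppose G is the edge-intersection of threshold graphs G₁, …, G_d, where G_i
-- is given by weights a_i and bound b_i. Call v light in G_i if 2 a_i(v) ≤ b_i.
-- Two light vertices of G_i have total weight at most b_i, so they are adjacent
-- in G_i; two heavy ones exceed b_i, so they are not. Hence the vertices light
-- in every G_i form a clique C of G, and colouring each remaining vertex by an
-- index i in which it is heavy is a proper d-colouring of G − C, so χ(G − C) ≤ d.
module Submission where

open import Defs
open import Data.Nat using (ℕ; _≤_; _<_; _≤?_)
open import Data.Nat.Properties using (≤-trans; ≮⇒≥)
open import Data.Nat.Induction using (<-wellFounded)
open import Data.Fin using (Fin; zero; suc)
open import Data.Fin.Properties using (_≟_; all?; ¬∀⟶∃¬)
open import Data.Bool using (Bool; true; false; _∨_; if_then_else_)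
open import Data.Bool.Properties using (∨-comm; ∨-zeroʳ; T-≡; T-not-≡)
open import Data.Rational using (ℚ; 0ℚ; _+_) renaming (_≤_ to _≤ℚ_; _<_ to _<ℚ_)
open import Data.Rational.Properties
  using ( +-identityˡ; +-identityʳ; +-comm; +-mono-≤; +-mono-<; <-irrefl; <-≤-trans; ≰⇒>
        ; +-0-commutativeMonoid)
  renaming (≮⇒≥ to ≮⇒≥ℚ; _≤?_ to _≤ℚ?_)
open import Algebra.Bundles using (CommutativeMonoid)
open import Algebra.Properties.CommutativeSemigroup
  (CommutativeMonoid.commutativeSemigroup +-0-commutativeMonoid) using (interchange)
open import Data.Product using (Σ; ∃-syntax; _×_; _,_; proj₁; proj₂)
open import Data.Sum using (_⊎_; inj₁; inj₂)
open import Induction.WellFounded using (Acc; acc)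
open import Relation.Nullary using (¬_; Dec; yes; no; does; isYes; contradiction)
open import Relation.Nullary.Decidable
  using (decidable-stable; dec-true; ¬¬-excluded-middle; toWitness; toWitnessFalse)
open import Relation.Binary.PropositionalEquality
  using (_≡_; _≢_; refl; cong; cong₂; trans; subst; module ≡-Reasoning)
  renaming (sym to ≡-sym)
open import Function using (_∘_)
open import Function.Bundles using (_⇔_; mk⇔; Equivalence)
open Equivalence using (to; from)

-- Colourability is undecidable for graphs with arbitrary adjacency types, so the
-- chromatic number only exists under double negation; as m ≤ d is decidable,
-- that suffices.
¬¬-least : {P : ℕ → Set} {d : ℕ} → P d → ¬ ¬ (∃[ c ] (P c × (∀ k → P k → c ≤ k)))
¬¬-least {P} = go (<-wellFounded _)
  where
  go : ∀ {d} → Acc _<_ d → P d → ¬ ¬ (∃[ c ] (P c × (∀ k → P k → c ≤ k)))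
  go {d} (acc rs) pd ¬least = ¬¬-excluded-middle {A = ∃[ k ] (k < d × P k)} λ where
    (yes (k , k<d , pk)) → go (rs k<d) pk ¬least
    (no none) → ¬least (d , pd , λ k pk → ≮⇒≥ λ k<d → none (k , k<d , pk))

double-cancel-≤ : ∀ {x y} → x + x ≤ℚ y + y → x ≤ℚ y
double-cancel-≤ x+x≤y+y = ≮⇒≥ℚ λ y<x → <-irrefl refl (<-≤-trans (+-mono-< y<x y<x) x+x≤y+y)

double-cancel-< : ∀ {x y} → x + x <ℚ y + y → x <ℚ y
double-cancel-< x+x<y+y = ≰⇒> λ y≤x → <-irrefl refl (<-≤-trans x+x<y+y (+-mono-≤ y≤x y≤x))

midpoint-≤ : ∀ {x y b} → x + x ≤ℚ b → y + y ≤ℚ b → x + y ≤ℚ b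
midpoint-≤ {x} {y} x+x≤b y+y≤b =
  double-cancel-≤ {x + y} (subst (_≤ℚ _) (interchange x x y y) (+-mono-≤ x+x≤b y+y≤b))

midpoint-> : ∀ {x y b} → b <ℚ x + x → b <ℚ y + y → b <ℚ x + y
midpoint-> {x} {y} {b} b<x+x b<y+y =
  double-cancel-< {b} {x + y} (subst (_ <ℚ_) (interchange x x y y) (+-mono-< b<x+x b<y+y))

private
  variable
    n : ℕ

⁅_⁆ : Fin n → Fin n → Bool
⁅ u ⁆ w = does (u ≟ w)

pair : Fin n → Fin n → Fin n → Bool
pair u v w = ⁅ u ⁆ w ∨ ⁅ v ⁆ w

u∈pair : (u v : Fin n) → pair u v u ≡ true
u∈pair u v = cong (_∨ ⁅ v ⁆ u) (dec-true (u ≟ u) refl)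

v∈pair : (u v : Fin n) → pair u v v ≡ true
v∈pair u v = subst (λ t → ⁅ u ⁆ v ∨ t ≡ true) (≡-sym (dec-true (v ≟ v) refl)) (∨-zeroʳ _)

∈pair⇒ : (u v : Fin n) {w : Fin n} → pair u v w ≡ true → u ≡ w ⊎ v ≡ w
∈pair⇒ u v {w} w∈ with u ≟ w | v ≟ w
... | yes u≡w | _       = inj₁ u≡w
... | no _    | yes v≡w = inj₂ v≡w

wsum-cong : (a : Fin n → ℚ) {x y : Fin n → Bool} → (∀ i → x i ≡ y i) → wsum a x ≡ wsum a y
wsum-cong {ℕ.zero}  a x≗y = refl
wsum-cong {ℕ.suc n} a x≗y =
  cong₂ _+_ (cong (λ t → if t then a zero else 0ℚ) (x≗y zero)) (wsum-cong (a ∘ suc) (x≗y ∘ suc))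

wsum-∅ : (a : Fin n → ℚ) → wsum a (λ _ → false) ≡ 0ℚ
wsum-∅ {ℕ.zero}  a = refl
wsum-∅ {ℕ.suc n} a = trans (+-identityˡ _) (wsum-∅ (a ∘ suc))

wsum-⁅⁆ : (a : Fin n → ℚ) (u : Fin n) → wsum a ⁅ u ⁆ ≡ a u
wsum-⁅⁆ a zero    = trans (cong (a zero +_) (wsum-∅ (a ∘ suc))) (+-identityʳ _)
wsum-⁅⁆ a (suc u) = trans (+-identityˡ _) (wsum-⁅⁆ (a ∘ suc) u)

wsum-pair : (a : Fin n → ℚ) {u v : Fin n} → u ≢ v → wsum a (pair u v) ≡ a u + a v
wsum-pair a {zero}  {zero}  u≢v = contradiction refl u≢v
wsum-pair a {zero}  {suc v} u≢v = cong (a zero +_) (wsum-⁅⁆ (a ∘ suc) v)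
wsum-pair a {suc u} {zero}  u≢v = begin
  wsum a (pair (suc u) zero)  ≡⟨ wsum-cong a (λ w → ∨-comm (⁅ suc u ⁆ w) (⁅ zero ⁆ w)) ⟩
  wsum a (pair zero (suc u))  ≡⟨ wsum-pair a (λ ()) ⟩
  a zero + a (suc u)          ≡⟨ +-comm (a zero) (a (suc u)) ⟩
  a (suc u) + a zero          ∎
  where open ≡-Reasoning
wsum-pair a {suc u} {suc v} u≢v =
  trans (+-identityˡ _) (wsum-pair (a ∘ suc) (λ u≡v → u≢v (cong suc u≡v)))

pair-clique⇔adj : (H : FinGraph n) {u v : Fin n} → u ≢ v → IsClique H (pair u v) ⇔ Adj H u v
pair-clique⇔adj H {u} {v} u≢v = mk⇔ (λ clique → clique u v (u∈pair u v) (v∈pair u v) u≢v) pair-clique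
  where
  pair-clique : Adj H u v → IsClique H (pair u v)
  pair-clique uv w w′ w∈ w′∈ w≢w′ with ∈pair⇒ u v w∈ | ∈pair⇒ u v w′∈
  ... | inj₁ refl | inj₁ refl = contradiction refl w≢w′
  ... | inj₁ refl | inj₂ refl = uv
  ... | inj₂ refl | inj₁ refl = sym H uv
  ... | inj₂ refl | inj₂ refl = contradiction refl w≢w′

module ThresholdGraph {n} (H : FinGraph n) (threshold : IsThreshold H) where

  weight : Fin n → ℚ
  weight = proj₁ threshold

  bound : ℚ
  bound = proj₁ (proj₂ threshold)

  adj⇔weight≤bound : ∀ {u v} → u ≢ v → Adj H u v ⇔ (weight u + weight v ≤ℚ bound)
  adj⇔weight≤bound {u} {v} u≢v = mk⇔
    (λ uv → subst (_≤ℚ bound) (wsum-pair weight u≢v) (from (clique⇔ (pair u v)) (from pair⇔ uv)))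
    (λ ≤b → to pair⇔ (to (clique⇔ (pair u v)) (subst (_≤ℚ bound) (≡-sym (wsum-pair weight u≢v)) ≤b)))
    where
    clique⇔ : ∀ x → (wsum weight x ≤ℚ bound) ⇔ IsClique H x
    clique⇔ = proj₂ (proj₂ threshold)
    pair⇔ : IsClique H (pair u v) ⇔ Adj H u v
    pair⇔ = pair-clique⇔adj H u≢v

  Light : Fin n → Set
  Light v = weight v + weight v ≤ℚ bound

  light? : ∀ v → Dec (Light v)
  light? v = weight v + weight v ≤ℚ? bound

  light-adjacent : ∀ {u v} → u ≢ v → Light u → Light v → Adj H u v
  light-adjacent {u} {v} u≢v light-u light-v =
    from (adj⇔weight≤bound u≢v) (midpoint-≤ {weight u} {weight v} light-u light-v)

  heavy-nonadjacent : ∀ {u v} → ¬ Light u → ¬ Light v → ¬ Adj H u v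
  heavy-nonadjacent {u} {v} heavy-u heavy-v uv =
    <-irrefl refl (<-≤-trans (midpoint-> {weight u} {weight v} (≰⇒> heavy-u) (≰⇒> heavy-v))
                             (to (adj⇔weight≤bound u≢v) uv))
    where
    u≢v : u ≢ v
    u≢v refl = irrefl H uv

module ThresholdIntersection {n d} (G : FinGraph n) (rep : ThresholdRep G d) where

  private
    module T (i : Fin d) = ThresholdGraph (proj₁ rep i) (proj₁ (proj₂ rep) i)

    adj⇔adj-all : ∀ u v → Adj G u v ⇔ (∀ i → Adj (proj₁ rep i) u v)
    adj⇔adj-all = proj₂ (proj₂ rep)

  lightCore : Fin n → Bool
  lightCore v = isYes (all? λ i → T.light? i v)

  lightCore⇒light : ∀ {v} → lightCore v ≡ true → ∀ i → T.Light i v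
  lightCore⇒light {v} v∈lightCore = toWitness {a? = all? λ i → T.light? i v} (from T-≡ v∈lightCore)

  ¬lightCore⇒heavy : ∀ {v} → lightCore v ≡ false → ∃[ i ] ¬ T.Light i v
  ¬lightCore⇒heavy {v} v∉lightCore = ¬∀⟶∃¬ d (λ i → T.Light i v) (λ i → T.light? i v)
    (toWitnessFalse {a? = all? λ i → T.light? i v} (from T-not-≡ v∉lightCore))

  lightCore-clique : IsClique G lightCore
  lightCore-clique u v u∈lightCore v∈lightCore u≢v =
    from (adj⇔adj-all u v) λ i →
      T.light-adjacent i u≢v (lightCore⇒light u∈lightCore i) (lightCore⇒light v∈lightCore i)

  heavy-index : Σ (Fin n) (λ v → lightCore v ≡ false) → Fin d
  heavy-index (v , v∉lightCore) = proj₁ (¬lightCore⇒heavy v∉lightCore)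

  heavy-index-colouring : Colorable (G － lightCore) d
  heavy-index-colouring = heavy-index , proper
    where
    proper : ∀ u v → Adj (G － lightCore) u v → heavy-index u ≢ heavy-index v
    proper (u , u∉lightCore) (v , v∉lightCore) uv i≡j =
      T.heavy-nonadjacent j heavy-u heavy-v (to (adj⇔adj-all u v) uv j)
      where
      j : Fin d
      j = heavy-index (v , v∉lightCore)
      heavy-u : ¬ T.Light j u
      heavy-u = subst (λ i → ¬ T.Light i u) i≡j (proj₂ (¬lightCore⇒heavy u∉lightCore))
      heavy-v : ¬ T.Light j v
      heavy-v = proj₂ (¬lightCore⇒heavy v∉lightCore)

proposition3 : ∀ (n : ℕ) (G : FinGraph n) (d m : ℕ) →
    IsThresholdDim G d → IsMinChiOverCliques G m → m ≤ d
proposition3 n G d m (rep , _) (_ , m-minimal) =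
  decidable-stable (m ≤? d) λ m≰d →
    ¬¬-least {Colorable (G － lightCore)} heavy-index-colouring λ { (χ , χ-chromatic) →
      m≰d (≤-trans (m-minimal lightCore χ lightCore-clique χ-chromatic)
                   (proj₂ χ-chromatic d heavy-index-colouring)) }
  where open ThresholdIntersection G rep
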